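{- For every nonnegative integer $n$, \[ \sum_{k=1}^n\binom nk\binom{n+k}k(-1)^{n-k}H_k=2H_n. \]
   Context: $H_m=\sum_{i=1}^m \frac1i$ denotes the $m$-th harmonic number, with $H_0=0$. -}

module Defs where

open import Data.Nat as ℕ using (ℕ; zero; suc)
open import Data.Nat.Combinatorics using (_C_)
open import Data.Integer as ℤ using (ℤ; +_)
open import Data.Rational using (ℚ; _/_; _+_; _*_; -_; 0ℚ; 1ℚ)

H : ℕ → ℚ
H zero = 0ℚ
H (suc m) = H m + ((+ 1) / suc m)

sgn : ℕ → ℚ
sgn zero = 1ℚ
sgn (suc j) = - sgn j

sumFrom1 : ℕ → (ℕ → ℚ) → ℚ
sumFrom1 zero f = 0ℚ
sumFrom1 (suc m) f = sumFrom1 m f + f (suc m)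

ι : ℕ → ℚ
ι m = (+ m) / 1

module Submission where

-- Write c n k = C(n,k) C(n+k,k) (-1)^(n-k) and S n = Σ_{k=1}^n c n k H_k.
-- As S 0 = 0, the theorem follows by induction from S (n+1) = S n + 2/(n+1).
--
-- This increment comes from a WZ-style recurrence for the coefficients,
--   c (n+1) (j+1) = c n (j+1) + e n (j+1) - e n j,
--   e n j = -2 (-1)^(n-j) C(n,j) C(n+j+1,j),
-- verified by clearing the denominator (j+1)^2 with the absorption identities.
-- Summing it against H_k, Abel summation turns the e-part into
-- -Σ_{j≤n} e n j/(j+1); by absorption and symmetry this equals 2/(n+1) times
-- Σ_j (-1)^(n-j) C(n,j) C(n+1+j,n), the n-th forward difference of the
-- degree-n polynomial x ↦ C(n+1+x,n), which is 1.

open import Defs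
open import Data.Nat using (ℕ; zero; suc; _∸_; pred; _<?_; s≤s; z≤n)
  renaming (_+_ to _+ℕ_; _*_ to _*ℕ_; _≤_ to _≤ℕ_)
import Data.Nat.Properties as ℕP
import Data.Nat.Solver as ℕSolver
open import Data.Nat.Combinatorics
  using (_C_; nCk+nC[k+1]≡[n+1]C[k+1]; k>n⇒nCk≡0; nC1≡n; nCk≡nC[n∸k])
open import Data.Nat.Coprimality using (1-coprimeTo) renaming (sym to coprime-sym)
import Data.Integer as ℤ
import Data.Integer.Properties as ℤP
open import Data.Rational using (ℚ; mkℚ; _+_; _*_; -_; _-_; _/_; 0ℚ; 1ℚ)
import Data.Rational.Properties as ℚP
open import Data.Rational.Solver using (module +-*-Solver)
open import Relation.Binary.PropositionalEquality
open import Relation.Nullary using (yes; no)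
open ≡-Reasoning
open +-*-Solver

ι-mkℚ : ∀ m → ι m ≡ mkℚ (ℤ.+ m) 0 (coprime-sym (1-coprimeTo m))
ι-mkℚ m = ℚP.normalize-coprime (coprime-sym (1-coprimeTo m))

ι-+ : ∀ a b → ι (a +ℕ b) ≡ ι a + ι b
ι-+ a b rewrite ι-mkℚ a | ι-mkℚ b = ℚP./-cong numerators refl
  where
  numerators : ℤ.+ (a +ℕ b) ≡ (ℤ.+ a ℤ.* ℤ.+ 1) ℤ.+ (ℤ.+ b ℤ.* ℤ.+ 1)
  numerators rewrite ℤP.*-identityʳ (ℤ.+ a) | ℤP.*-identityʳ (ℤ.+ b) = ℤP.pos-+ a b

ι-* : ∀ a b → ι (a *ℕ b) ≡ ι a * ι b
ι-* a b rewrite ι-mkℚ a | ι-mkℚ b = ℚP./-cong (ℤP.pos-* a b) refl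

ι-suc : ∀ m → ι (suc m) ≡ 1ℚ + ι m
ι-suc m = ι-+ 1 m

recip : ℕ → ℚ
recip m = (ℤ.+ 1) / suc m

recip-inverse : ∀ m → ι (suc m) * recip m ≡ 1ℚ
recip-inverse m
  rewrite ι-mkℚ (suc m) | ℚP.normalize-coprime {1} {m} (1-coprimeTo (suc m))
  = ℚP.*-inverseʳ (mkℚ (ℤ.+ suc m) 0 (coprime-sym (1-coprimeTo (suc m))))

cancel-square : ∀ {x y a b} → x * y ≡ 1ℚ → x * x * a ≡ x * x * b → a ≡ b
cancel-square {x} {y} {a} {b} xy≡1 eq = begin
  a                   ≡⟨ unfold a ⟩
  y * y * (x * x * a) ≡⟨ cong (y * y *_) eq ⟩
  y * y * (x * x * b) ≡⟨ sym (unfold b) ⟩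
  b                   ∎
  where
  unfold : ∀ q → q ≡ y * y * (x * x * q)
  unfold q = begin
    q                     ≡⟨ solve 1 (λ q → q := q :* con 1ℚ :* con 1ℚ) refl q ⟩
    q * 1ℚ * 1ℚ           ≡⟨ cong₂ (λ s t → q * s * t) (sym xy≡1) (sym xy≡1) ⟩
    q * (x * y) * (x * y) ≡⟨ solve 3 (λ q x y → q :* (x :* y) :* (x :* y) := y :* y :* (x :* x :* q)) refl q x y ⟩
    y * y * (x * x * q)   ∎

cross-divide : ∀ {p q rp rq a b} → p * rp ≡ 1ℚ → q * rq ≡ 1ℚ →
               p * a ≡ q * b → a * rq ≡ b * rp
cross-divide {p} {q} {rp} {rq} {a} {b} p-inv q-inv eq = begin
  a * rq              ≡⟨ solve 2 (λ a r → a :* r := a :* r :* con 1ℚ) refl a rq ⟩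
  a * rq * 1ℚ         ≡⟨ cong (a * rq *_) (sym p-inv) ⟩
  a * rq * (p * rp)   ≡⟨ solve 4 (λ a r p s → a :* r :* (p :* s) := (p :* a) :* r :* s) refl a rq p rp ⟩
  (p * a) * rq * rp   ≡⟨ cong (λ z → z * rq * rp) eq ⟩
  (q * b) * rq * rp   ≡⟨ solve 4 (λ q b r s → (q :* b) :* r :* s := b :* (q :* r) :* s) refl q b rq rp ⟩
  b * (q * rq) * rp   ≡⟨ cong (λ z → b * z * rp) q-inv ⟩
  b * 1ℚ * rp         ≡⟨ solve 2 (λ b s → b :* con 1ℚ :* s := b :* s) refl b rp ⟩
  b * rp              ∎

absorptionℕ : ∀ n k → suc k *ℕ (suc n C suc k) ≡ suc n *ℕ (n C k)
absorptionℕ zero zero = refl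
absorptionℕ zero (suc k) = begin
  suc (suc k) *ℕ (1 C suc (suc k)) ≡⟨ cong (suc (suc k) *ℕ_) (k>n⇒nCk≡0 (s≤s (s≤s (z≤n {k})))) ⟩
  suc (suc k) *ℕ 0                 ≡⟨ ℕP.*-zeroʳ (suc (suc k)) ⟩
  0                                ≡⟨ cong (1 *ℕ_) (k>n⇒nCk≡0 (s≤s (z≤n {k}))) ⟨
  1 *ℕ (0 C suc k)                 ∎
absorptionℕ (suc n) zero = trans (ℕP.*-identityˡ (suc (suc n) C 1))
  (trans (nC1≡n (suc (suc n))) (sym (ℕP.*-identityʳ (suc (suc n)))))
absorptionℕ (suc n) (suc k) = begin
  suc (suc k) *ℕ (suc (suc n) C suc (suc k))
    ≡⟨ cong (suc (suc k) *ℕ_) (sym (nCk+nC[k+1]≡[n+1]C[k+1] (suc n) (suc k))) ⟩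
  suc (suc k) *ℕ (P +ℕ Q)
    ≡⟨ NS.solve 3 (λ k P Q → (NS.con 2 NS.:+ k) NS.:* (P NS.:+ Q)
                      NS.:= ((NS.con 1 NS.:+ k) NS.:* P NS.:+ P) NS.:+ (NS.con 2 NS.:+ k) NS.:* Q) refl k P Q ⟩
  (suc k *ℕ P +ℕ P) +ℕ suc (suc k) *ℕ Q
    ≡⟨ cong₂ (λ x y → (x +ℕ P) +ℕ y) (absorptionℕ n k) (absorptionℕ n (suc k)) ⟩
  (suc n *ℕ (n C k) +ℕ P) +ℕ suc n *ℕ (n C suc k)
    ≡⟨ NS.solve 4 (λ m a b P → (m NS.:* a NS.:+ P) NS.:+ m NS.:* b NS.:= m NS.:* (a NS.:+ b) NS.:+ P)
                  refl (suc n) (n C k) (n C suc k) P ⟩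
  suc n *ℕ (n C k +ℕ n C suc k) +ℕ P
    ≡⟨ cong (λ x → suc n *ℕ x +ℕ P) (nCk+nC[k+1]≡[n+1]C[k+1] n k) ⟩
  suc n *ℕ P +ℕ P
    ≡⟨ ℕP.+-comm (suc n *ℕ P) P ⟩
  suc (suc n) *ℕ P ∎
  where
  module NS = ℕSolver.+-*-Solver
  P = suc n C suc k
  Q = suc n C suc (suc k)

pascal : ∀ n k → ι (suc n C suc k) ≡ ι (n C k) + ι (n C suc k)
pascal n k = trans (cong ι (sym (nCk+nC[k+1]≡[n+1]C[k+1] n k))) (ι-+ (n C k) (n C suc k))

absorption : ∀ n k → ι (suc k) * ι (suc n C suc k) ≡ ι (suc n) * ι (n C k)
absorption n k = begin
  ι (suc k) * ι (suc n C suc k) ≡⟨ sym (ι-* (suc k) (suc n C suc k)) ⟩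
  ι (suc k *ℕ (suc n C suc k))  ≡⟨ cong ι (absorptionℕ n k) ⟩
  ι (suc n *ℕ (n C k))          ≡⟨ ι-* (suc n) (n C k) ⟩
  ι (suc n) * ι (n C k)         ∎

absorption-lower : ∀ n k → ι (suc k) * ι (n C suc k) ≡ (ι n - ι k) * ι (n C k)
absorption-lower n k = begin
  x * ι (n C suc k)
    ≡⟨ solve 3 (λ x u b → x :* b := x :* (u :+ b) :- x :* u) refl x u (ι (n C suc k)) ⟩
  x * (u + ι (n C suc k)) - x * u
    ≡⟨ cong (λ z → x * z - x * u) (sym (pascal n k)) ⟩
  x * ι (suc n C suc k) - x * u
    ≡⟨ cong (_- x * u) (absorption n k) ⟩
  ι (suc n) * u - x * u
    ≡⟨ cong₂ (λ p q → p * u - q * u) (ι-suc n) (ι-suc k) ⟩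
  (1ℚ + ι n) * u - (1ℚ + ι k) * u
    ≡⟨ solve 3 (λ N K u → (con 1ℚ :+ N) :* u :- (con 1ℚ :+ K) :* u := (N :- K) :* u) refl (ι n) (ι k) u ⟩
  (ι n - ι k) * u ∎
  where
  x = ι (suc k)
  u = ι (n C k)

absorption-diagonal : ∀ n j →
  ι (suc j) * ι (suc (n +ℕ j) C suc j) ≡ ι (suc n) * ι (suc (n +ℕ j) C j)
absorption-diagonal n j = begin
  ι (suc j) * ι (suc (n +ℕ j) C suc j)     ≡⟨ absorption-lower (suc (n +ℕ j)) j ⟩
  (ι (suc (n +ℕ j)) - ι j) * v            ≡⟨ cong (λ z → (z - ι j) * v) (trans (ι-suc (n +ℕ j)) (cong (1ℚ +_) (ι-+ n j))) ⟩
  ((1ℚ + (ι n + ι j)) - ι j) * v          ≡⟨ solve 3 (λ N J v → ((con 1ℚ :+ (N :+ J)) :- J) :* v := (con 1ℚ :+ N) :* v) refl (ι n) (ι j) v ⟩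
  (1ℚ + ι n) * v                          ≡⟨ cong (_* v) (sym (ι-suc n)) ⟩
  ι (suc n) * v                           ∎
  where
  v = ι (suc (n +ℕ j) C j)

symmetry : ∀ n j → (suc n +ℕ j) C n ≡ suc (n +ℕ j) C suc j
symmetry n j = trans (nCk≡nC[n∸k] n≤) (cong (suc (n +ℕ j) C_) complement)
  where
  n≤ : n ≤ℕ suc (n +ℕ j)
  n≤ = ℕP.m≤n⇒m≤1+n (ℕP.m≤m+n n j)
  complement : suc (n +ℕ j) ∸ n ≡ suc j
  complement = trans (cong (_∸ n) (sym (ℕP.+-suc n j))) (ℕP.m+n∸m≡n n (suc j))

binomial-above : ∀ n → ι (n C suc n) ≡ 0ℚ
binomial-above n = cong ι (k>n⇒nCk≡0 (ℕP.n<1+n n))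

-- Sign change across one step: (-1)^(n-i) = -(-1)^(n-i-1) whenever C(n,i+1) ≠ 0.
sign-step : ∀ n i → sgn (n ∸ i) * ι (n C suc i) ≡ - (sgn (n ∸ suc i) * ι (n C suc i))
sign-step n i with i <? n
... | yes i<n = trans (cong (λ m → sgn m * ι (n C suc i)) (ℕP.+-∸-assoc 1 i<n))
                      (sym (ℚP.neg-distribˡ-* (sgn (n ∸ suc i)) (ι (n C suc i))))
... | no i≮n = begin
  sgn (n ∸ i) * ι (n C suc i)            ≡⟨ cong (λ m → sgn (n ∸ i) * ι m) vanishes ⟩
  sgn (n ∸ i) * 0ℚ                       ≡⟨ solve 2 (λ a b → a :* con 0ℚ := :- (b :* con 0ℚ)) refl (sgn (n ∸ i)) (sgn (n ∸ suc i)) ⟩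
  - (sgn (n ∸ suc i) * 0ℚ)               ≡⟨ cong (λ m → - (sgn (n ∸ suc i) * ι m)) vanishes ⟨
  - (sgn (n ∸ suc i) * ι (n C suc i))    ∎
  where
  vanishes : n C suc i ≡ 0
  vanishes = k>n⇒nCk≡0 (s≤s (ℕP.≮⇒≥ i≮n))

sumTo : ℕ → (ℕ → ℚ) → ℚ
sumTo zero g = 0ℚ
sumTo (suc N) g = sumTo N g + g N

sumTo-cong : ∀ N {f g : ℕ → ℚ} → (∀ j → f j ≡ g j) → sumTo N f ≡ sumTo N g
sumTo-cong zero f≗g = refl
sumTo-cong (suc N) f≗g = cong₂ _+_ (sumTo-cong N f≗g) (f≗g N)

sumTo-sub : ∀ N f g → sumTo N (λ j → f j - g j) ≡ sumTo N f - sumTo N g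
sumTo-sub zero f g = refl
sumTo-sub (suc N) f g = trans (cong (_+ (f N - g N)) (sumTo-sub N f g))
  (solve 4 (λ a b c d → (a :- b) :+ (c :- d) := (a :+ c) :- (b :+ d)) refl (sumTo N f) (sumTo N g) (f N) (g N))

sumTo-scale : ∀ N a f → sumTo N (λ j → a * f j) ≡ a * sumTo N f
sumTo-scale zero a f = sym (ℚP.*-zeroʳ a)
sumTo-scale (suc N) a f = trans (cong (_+ a * f N) (sumTo-scale N a f))
  (sym (ℚP.*-distribˡ-+ a (sumTo N f) (f N)))

sumTo-shift : ∀ N g → sumTo (suc N) g ≡ g 0 + sumTo N (λ i → g (suc i))
sumTo-shift zero g = ℚP.+-comm 0ℚ (g 0)
sumTo-shift (suc N) g = trans (cong (_+ g (suc N)) (sumTo-shift N g))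
  (ℚP.+-assoc (g 0) (sumTo N (λ i → g (suc i))) (g (suc N)))

sumFrom1-cong : ∀ N {f g : ℕ → ℚ} → (∀ j → f (suc j) ≡ g (suc j)) → sumFrom1 N f ≡ sumFrom1 N g
sumFrom1-cong zero f≗g = refl
sumFrom1-cong (suc N) f≗g = cong₂ _+_ (sumFrom1-cong N f≗g) (f≗g N)

sumFrom1-+ : ∀ N f g → sumFrom1 N (λ j → f j + g j) ≡ sumFrom1 N f + sumFrom1 N g
sumFrom1-+ zero f g = refl
sumFrom1-+ (suc N) f g = trans (cong (_+ (f (suc N) + g (suc N))) (sumFrom1-+ N f g))
  (solve 4 (λ a b c d → (a :+ b) :+ (c :+ d) := (a :+ c) :+ (b :+ d)) refl
     (sumFrom1 N f) (sumFrom1 N g) (f (suc N)) (g (suc N)))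

abel : ∀ (g : ℕ → ℚ) N →
  sumFrom1 N (λ k → (g k - g (pred k)) * H k) ≡ g N * H N - sumTo N (λ j → g j * recip j)
abel g zero = solve 1 (λ a → con 0ℚ := a :* con 0ℚ :- con 0ℚ) refl (g 0)
abel g (suc N) = trans (cong (_+ (g (suc N) - g N) * (H N + recip N)) (abel g N))
  (solve 6 (λ a b h x S W → (b :* h :- S) :+ (a :- b) :* (h :+ W) := a :* (h :+ W) :- (S :+ b :* W)) refl
     (g (suc N)) (g N) (H N) (g N * recip N) (sumTo N (λ j → g j * recip j)) (recip N))

Δ : (ℕ → ℚ) → ℕ → ℚ
Δ p j = p (suc j) - p j

nthDifference : ℕ → (ℕ → ℚ) → ℚ
nthDifference n p = sumTo (suc n) (λ j → sgn (n ∸ j) * ι (n C j) * p j)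

-- Δ^(n+1) p = Δⁿ (Δ p): split C(n+1,j) by Pascal's rule and reindex.
nthDifference-suc : ∀ n p → nthDifference (suc n) p ≡ nthDifference n (Δ p)
nthDifference-suc n p = begin
  sumTo (suc (suc n)) F
    ≡⟨ sumTo-shift (suc n) F ⟩
  F 0 + sumTo (suc n) (λ i → F (suc i))
    ≡⟨ cong₂ _+_ first-term (sumTo-cong (suc n) pascal-split) ⟩
  - K 0 + sumTo (suc n) (λ i → A i - K (suc i))
    ≡⟨ cong (- K 0 +_) (sumTo-sub (suc n) A (λ i → K (suc i))) ⟩
  - K 0 + (sumTo (suc n) A - sumTo (suc n) (λ i → K (suc i)))
    ≡⟨ solve 3 (λ a b c → :- a :+ (b :- c) := b :- (a :+ c)) refl (K 0) (sumTo (suc n) A) (sumTo (suc n) (λ i → K (suc i))) ⟩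
  sumTo (suc n) A - (K 0 + sumTo (suc n) (λ i → K (suc i)))
    ≡⟨ cong (λ z → sumTo (suc n) A - z) (sym (sumTo-shift (suc n) K)) ⟩
  sumTo (suc n) A - (sumTo (suc n) K + K (suc n))
    ≡⟨ cong (λ z → sumTo (suc n) A - (sumTo (suc n) K + z)) last-term ⟩
  sumTo (suc n) A - (sumTo (suc n) K + 0ℚ)
    ≡⟨ cong (λ z → sumTo (suc n) A - z) (ℚP.+-identityʳ (sumTo (suc n) K)) ⟩
  sumTo (suc n) A - sumTo (suc n) K
    ≡⟨ sym (sumTo-sub (suc n) A K) ⟩
  sumTo (suc n) (λ j → A j - K j)
    ≡⟨ sumTo-cong (suc n) (λ j → solve 4 (λ s c a b → s :* c :* a :- s :* c :* b := s :* c :* (a :- b)) refl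
                                             (sgn (n ∸ j)) (ι (n C j)) (p (suc j)) (p j)) ⟩
  nthDifference n (Δ p) ∎
  where
  F K A : ℕ → ℚ
  F j = sgn (suc n ∸ j) * ι (suc n C j) * p j
  K j = sgn (n ∸ j) * ι (n C j) * p j
  A j = sgn (n ∸ j) * ι (n C j) * p (suc j)
  first-term : F 0 ≡ - K 0
  first-term = solve 2 (λ s q → (:- s) :* con 1ℚ :* q := :- (s :* con 1ℚ :* q)) refl (sgn n) (p 0)
  last-term : K (suc n) ≡ 0ℚ
  last-term = trans (cong (λ z → sgn (n ∸ suc n) * z * p (suc n)) (binomial-above n))
    (solve 2 (λ s q → s :* con 0ℚ :* q := con 0ℚ) refl (sgn (n ∸ suc n)) (p (suc n)))
  pascal-split : ∀ i → F (suc i) ≡ A i - K (suc i)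
  pascal-split i = begin
    s * ι (suc n C suc i) * q
      ≡⟨ cong (λ z → s * z * q) (pascal n i) ⟩
    s * (ι (n C i) + b) * q
      ≡⟨ solve 4 (λ s a b q → s :* (a :+ b) :* q := s :* a :* q :+ (s :* b) :* q) refl s (ι (n C i)) b q ⟩
    A i + (s * b) * q
      ≡⟨ cong (λ z → A i + z * q) (sign-step n i) ⟩
    A i + (- (sgn (n ∸ suc i) * b)) * q
      ≡⟨ cong (A i +_) (sym (ℚP.neg-distribˡ-* (sgn (n ∸ suc i) * b) q)) ⟩
    A i - K (suc i) ∎
    where
    s = sgn (n ∸ i)
    b = ι (n C suc i)
    q = p (suc i)

nthDifference-binomial : ∀ n a → nthDifference n (λ j → ι ((a +ℕ j) C n)) ≡ 1ℚ
nthDifference-binomial zero a = refl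
nthDifference-binomial (suc n) a = begin
  nthDifference (suc n) p
    ≡⟨ nthDifference-suc n p ⟩
  nthDifference n (Δ p)
    ≡⟨ sumTo-cong (suc n) (λ j → cong (sgn (n ∸ j) * ι (n C j) *_) (Δp j)) ⟩
  nthDifference n (λ j → ι ((a +ℕ j) C n))
    ≡⟨ nthDifference-binomial n a ⟩
  1ℚ ∎
  where
  p : ℕ → ℚ
  p j = ι ((a +ℕ j) C suc n)
  Δp : ∀ j → Δ p j ≡ ι ((a +ℕ j) C n)
  Δp j = begin
    ι ((a +ℕ suc j) C suc n) - p j  ≡⟨ cong (λ m → ι (m C suc n) - p j) (ℕP.+-suc a j) ⟩
    ι (suc (a +ℕ j) C suc n) - p j  ≡⟨ cong (_- p j) (pascal (a +ℕ j) n) ⟩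
    (ι ((a +ℕ j) C n) + p j) - p j  ≡⟨ solve 2 (λ x y → (x :+ y) :- y := x) refl (ι ((a +ℕ j) C n)) (p j) ⟩
    ι ((a +ℕ j) C n)                ∎

c : ℕ → ℕ → ℚ
c n k = ι (n C k) * ι ((n +ℕ k) C k) * sgn (n ∸ k)

e : ℕ → ℕ → ℚ
e n j = - (ι 2 * sgn (n ∸ j) * ι (n C j) * ι (suc (n +ℕ j) C j))

-- The recurrence as a field identity: C₁..C₄ stand for C(n+1,j+1), C(n,j+1),
-- C(n+j+2,j+1), C(n+j+1,j+1); u, v for C(n,j), C(n+j+1,j); s, t for the
-- signs (-1)^(n-j), (-1)^(n-j-1); x = j+1 has inverse y.
recurrence-identity : ∀ (N J u v s t C₁ C₂ C₃ C₄ x y n₁ m₂ : ℚ) →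
  x ≡ 1ℚ + J → n₁ ≡ 1ℚ + N → m₂ ≡ 1ℚ + (1ℚ + (N + J)) → x * y ≡ 1ℚ →
  x * C₁ ≡ n₁ * u → x * C₂ ≡ (N - J) * u → x * C₃ ≡ m₂ * v → x * C₄ ≡ n₁ * v →
  s * C₂ ≡ - (t * C₂) →
  C₁ * C₃ * s ≡ C₂ * C₄ * t + (- (ι 2 * t * C₂ * C₃) - - (ι 2 * s * u * v))
recurrence-identity N J u v s t C₁ C₂ C₃ C₄ x y n₁ m₂ refl refl refl xy≡1 h₁ h₂ h₃ h₄ sign =
  cancel-square {x} {y} xy≡1 (trans lhs (sym rhs))
  where
  -- Both sides times x², expressed through u and v.
  lhs : x * x * (C₁ * C₃ * s) ≡ (n₁ * u) * (m₂ * v) * s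
  lhs = trans (solve 4 (λ x a b s → x :* x :* (a :* b :* s) := (x :* a) :* (x :* b) :* s) refl x C₁ C₃ s)
              (cong₂ (λ a b → a * b * s) h₁ h₃)
  tC₂ : t * C₂ ≡ - (s * C₂)
  tC₂ = trans (solve 1 (λ a → a := :- (:- a)) refl (t * C₂)) (cong -_ (sym sign))
  rhs : x * x * (C₂ * C₄ * t + (- (ι 2 * t * C₂ * C₃) - - (ι 2 * s * u * v))) ≡ (n₁ * u) * (m₂ * v) * s
  rhs = begin
    x * x * (C₂ * C₄ * t + (- (ι 2 * t * C₂ * C₃) - - (ι 2 * s * u * v)))
      ≡⟨ solve 9 (λ x C₂ C₃ C₄ t s u v k → x :* x :* (C₂ :* C₄ :* t :+ (:- (k :* t :* C₂ :* C₃) :- :- (k :* s :* u :* v)))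
                     := (t :* C₂) :* x :* (x :* C₄ :- k :* (x :* C₃)) :+ k :* s :* u :* v :* x :* x)
                  refl x C₂ C₃ C₄ t s u v (ι 2) ⟩
    (t * C₂) * x * (x * C₄ - ι 2 * (x * C₃)) + ι 2 * s * u * v * x * x
      ≡⟨ cong (λ z → z * x * (x * C₄ - ι 2 * (x * C₃)) + ι 2 * s * u * v * x * x) tC₂ ⟩
    (- (s * C₂)) * x * (x * C₄ - ι 2 * (x * C₃)) + ι 2 * s * u * v * x * x
      ≡⟨ solve 8 (λ s C₂ x C₄ C₃ k u v → (:- (s :* C₂)) :* x :* (x :* C₄ :- k :* (x :* C₃)) :+ k :* s :* u :* v :* x :* x
                   := (:- s) :* (x :* C₂) :* (x :* C₄ :- k :* (x :* C₃)) :+ k :* s :* u :* v :* x :* x)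
                  refl s C₂ x C₄ C₃ (ι 2) u v ⟩
    (- s) * (x * C₂) * (x * C₄ - ι 2 * (x * C₃)) + ι 2 * s * u * v * x * x
      ≡⟨ cong₂ (λ a b → (- s) * a * b + ι 2 * s * u * v * x * x) h₂ (cong₂ (λ a b → a - ι 2 * b) h₄ h₃) ⟩
    (- s) * ((N - J) * u) * (n₁ * v - ι 2 * (m₂ * v)) + ι 2 * s * u * v * x * x
      ≡⟨ solve 5 (λ N J u v s → (:- s) :* ((N :- J) :* u) :* ((con 1ℚ :+ N) :* v :- (con 1ℚ :+ con 1ℚ) :* ((con 1ℚ :+ (con 1ℚ :+ (N :+ J))) :* v))
                                  :+ (con 1ℚ :+ con 1ℚ) :* s :* u :* v :* (con 1ℚ :+ J) :* (con 1ℚ :+ J)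
                   := ((con 1ℚ :+ N) :* u) :* ((con 1ℚ :+ (con 1ℚ :+ (N :+ J))) :* v) :* s)
                  refl N J u v s ⟩
    (n₁ * u) * (m₂ * v) * s ∎

c-recurrence : ∀ n j → c (suc n) (suc j) ≡ c n (suc j) + (e n (suc j) - e n j)
c-recurrence n j = recurrence-identity (ι n) (ι j) (ι (n C j)) (ι (suc (n +ℕ j) C j))
  (sgn (n ∸ j)) (sgn (n ∸ suc j))
  (ι (suc n C suc j)) (ι (n C suc j)) (ι (suc (n +ℕ suc j) C suc j)) (ι ((n +ℕ suc j) C suc j))
  (ι (suc j)) (recip j) (ι (suc n)) (ι (suc (suc (n +ℕ j))))
  (ι-suc j) (ι-suc n) n+j+2 (recip-inverse j) (absorption n j) (absorption-lower n j) upper diagonal (sign-step n j)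
  where
  n+j+2 : ι (suc (suc (n +ℕ j))) ≡ 1ℚ + (1ℚ + (ι n + ι j))
  n+j+2 = trans (ι-suc (suc (n +ℕ j))) (cong (1ℚ +_) (trans (ι-suc (n +ℕ j)) (cong (1ℚ +_) (ι-+ n j))))
  upper : ι (suc j) * ι (suc (n +ℕ suc j) C suc j) ≡ ι (suc (suc (n +ℕ j))) * ι (suc (n +ℕ j) C j)
  upper = subst (λ m → ι (suc j) * ι (suc m C suc j) ≡ ι (suc (suc (n +ℕ j))) * ι (suc (n +ℕ j) C j))
                (sym (ℕP.+-suc n j)) (absorption (suc (n +ℕ j)) j)
  diagonal : ι (suc j) * ι ((n +ℕ suc j) C suc j) ≡ ι (suc n) * ι (suc (n +ℕ j) C j)
  diagonal = subst (λ m → ι (suc j) * ι (m C suc j) ≡ ι (suc n) * ι (suc (n +ℕ j) C j))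
                   (sym (ℕP.+-suc n j)) (absorption-diagonal n j)

c-above : ∀ n → c n (suc n) ≡ 0ℚ
c-above n = trans (cong (λ z → z * ι ((n +ℕ suc n) C suc n) * sgn (n ∸ suc n)) (binomial-above n))
  (solve 2 (λ a s → con 0ℚ :* a :* s := con 0ℚ) refl (ι ((n +ℕ suc n) C suc n)) (sgn (n ∸ suc n)))

e-above : ∀ n → e n (suc n) ≡ 0ℚ
e-above n = trans (cong (λ z → - (ι 2 * sgn (n ∸ suc n) * z * ι (suc (n +ℕ suc n) C suc n))) (binomial-above n))
  (solve 3 (λ k s v → :- (k :* s :* con 0ℚ :* v) := con 0ℚ) refl (ι 2) (sgn (n ∸ suc n)) (ι (suc (n +ℕ suc n) C suc n)))

-- Σ_{j≤n} e n j/(j+1) = -2/(n+1): by absorption and symmetry each term is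
-- -2/(n+1) (-1)^(n-j) C(n,j) C(n+1+j,n), whose sum is an n-th difference.
certificate-sum : ∀ n → sumTo (suc n) (λ j → e n j * recip j) ≡ - (ι 2 * recip n)
certificate-sum n = begin
  sumTo (suc n) (λ j → e n j * recip j)
    ≡⟨ sumTo-cong (suc n) term ⟩
  sumTo (suc n) (λ j → - (ι 2 * recip n) * (sgn (n ∸ j) * ι (n C j) * ι ((suc n +ℕ j) C n)))
    ≡⟨ sumTo-scale (suc n) (- (ι 2 * recip n)) (λ j → sgn (n ∸ j) * ι (n C j) * ι ((suc n +ℕ j) C n)) ⟩
  - (ι 2 * recip n) * nthDifference n (λ j → ι ((suc n +ℕ j) C n))
    ≡⟨ cong (- (ι 2 * recip n) *_) (nthDifference-binomial n (suc n)) ⟩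
  - (ι 2 * recip n) * 1ℚ
    ≡⟨ ℚP.*-identityʳ _ ⟩
  - (ι 2 * recip n) ∎
  where
  term : ∀ j → e n j * recip j ≡ - (ι 2 * recip n) * (sgn (n ∸ j) * ι (n C j) * ι ((suc n +ℕ j) C n))
  term j = begin
    - (ι 2 * s * u * v) * recip j
      ≡⟨ solve 5 (λ k s u v r → :- (k :* s :* u :* v) :* r := :- (k :* s :* u) :* (v :* r)) refl (ι 2) s u v (recip j) ⟩
    - (ι 2 * s * u) * (v * recip j)
      ≡⟨ cong (- (ι 2 * s * u) *_) (cross-divide {ι (suc n)} {ι (suc j)} {recip n} {recip j} {v} {v′} (recip-inverse n) (recip-inverse j) (sym (absorption-diagonal n j))) ⟩
    - (ι 2 * s * u) * (v′ * recip n)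
      ≡⟨ solve 5 (λ k s u v r → :- (k :* s :* u) :* (v :* r) := (:- (k :* r)) :* (s :* u :* v)) refl (ι 2) s u v′ (recip n) ⟩
    - (ι 2 * recip n) * (s * u * v′)
      ≡⟨ cong (λ m → - (ι 2 * recip n) * (s * u * ι m)) (sym (symmetry n j)) ⟩
    - (ι 2 * recip n) * (s * u * ι ((suc n +ℕ j) C n)) ∎
    where
    s = sgn (n ∸ j)
    u = ι (n C j)
    v = ι (suc (n +ℕ j) C j)
    v′ = ι (suc (n +ℕ j) C suc j)

S : ℕ → ℚ
S n = sumFrom1 n (λ k → c n k * H k)

S-step : ∀ n → S (suc n) ≡ S n + ι 2 * recip n
S-step n = begin
  sumFrom1 (suc n) (λ k → c (suc n) k * H k)
    ≡⟨ sumFrom1-cong (suc n) split ⟩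
  sumFrom1 (suc n) (λ k → c n k * H k + (e n k - e n (pred k)) * H k)
    ≡⟨ sumFrom1-+ (suc n) (λ k → c n k * H k) (λ k → (e n k - e n (pred k)) * H k) ⟩
  (S n + c n (suc n) * H (suc n)) + sumFrom1 (suc n) (λ k → (e n k - e n (pred k)) * H k)
    ≡⟨ cong ((S n + c n (suc n) * H (suc n)) +_) (abel (e n) (suc n)) ⟩
  (S n + c n (suc n) * H (suc n)) + (e n (suc n) * H (suc n) - sumTo (suc n) (λ j → e n j * recip j))
    ≡⟨ cong₂ (λ a b → (S n + a * H (suc n)) + (b * H (suc n) - sumTo (suc n) (λ j → e n j * recip j))) (c-above n) (e-above n) ⟩
  (S n + 0ℚ * H (suc n)) + (0ℚ * H (suc n) - sumTo (suc n) (λ j → e n j * recip j))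
    ≡⟨ cong (λ z → (S n + 0ℚ * H (suc n)) + (0ℚ * H (suc n) - z)) (certificate-sum n) ⟩
  (S n + 0ℚ * H (suc n)) + (0ℚ * H (suc n) - - (ι 2 * recip n))
    ≡⟨ solve 3 (λ S h t → (S :+ con 0ℚ :* h) :+ (con 0ℚ :* h :- :- t) := S :+ t) refl (S n) (H (suc n)) (ι 2 * recip n) ⟩
  S n + ι 2 * recip n ∎
  where
  split : ∀ j → c (suc n) (suc j) * H (suc j) ≡ c n (suc j) * H (suc j) + (e n (suc j) - e n j) * H (suc j)
  split j = trans (cong (_* H (suc j)) (c-recurrence n j))
                  (ℚP.*-distribʳ-+ (H (suc j)) (c n (suc j)) (e n (suc j) - e n j))

mainTheorem3 : (n : ℕ) →
    sumFrom1 n (λ k → ι (n C k) * ι ((n +ℕ k) C k) * sgn (n ∸ k) * H k)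
      ≡ ι 2 * H n
mainTheorem3 zero = refl
mainTheorem3 (suc n) = begin
  S (suc n)                   ≡⟨ S-step n ⟩
  S n + ι 2 * recip n         ≡⟨ cong (_+ ι 2 * recip n) (mainTheorem3 n) ⟩
  ι 2 * H n + ι 2 * recip n   ≡⟨ sym (ℚP.*-distribˡ-+ (ι 2) (H n) (recip n)) ⟩
  ι 2 * H (suc n)             ∎
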